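{- Let $K_n$ be the complete graph on $n\ge 2$ vertices and let $L$ be its Laplacian matrix. Then \[ \operatorname{per}(L\circ L)\ \le\ \operatorname{per}(L)^2. \]
   Context: The Laplacian of a simple graph is $L=D-A$ (degree matrix minus adjacency matrix); for $K_n$ this is $nI_n-J_n$ with $J_n$ the all-ones matrix. $\operatorname{per}$ denotes the permanent and $\circ$ the Hadamard (entrywise) product. -}

module Defs where

open import Data.Nat using (ℕ; zero; suc)
open import Data.Integer using (ℤ; +_; _+_; _-_; _*_)
open import Data.Fin using (Fin; zero; suc; _≟_)
open import Data.Fin.Properties using (all?)
open import Data.List using (List; []; _∷_; map; concatMap; filter; foldr)
open import Data.Bool using (Bool; true; false)
open import Relation.Nullary using (Dec; yes; no; ¬_)
open import Relation.Binary.PropositionalEquality using (_≡_)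
open import Function.Definitions using (Injective)

Matrix : ℕ → Set
Matrix n = Fin n → Fin n → ℤ

allFuns : (n m : ℕ) → List (Fin n → Fin m)
allFuns zero m = (λ ()) ∷ []
allFuns (suc n) m =
  concatMap (λ f → map (λ j → λ { zero → j ; (suc i) → f i }) (Data.List.allFin m)) (allFuns n m)
  where import Data.List

injective? : ∀ {n} (σ : Fin n → Fin n) → Dec (∀ i j → σ i ≡ σ j → i ≡ j)
injective? σ = all? (λ i → all? (λ j → dec i j))
  where
  open import Relation.Nullary using (_→-dec_)
  dec : ∀ i j → Dec (σ i ≡ σ j → i ≡ j)
  dec i j = (σ i ≟ σ j) →-dec (i ≟ j)

permutations : (n : ℕ) → List (Fin n → Fin n)
permutations n = filter injective? (allFuns n n)

prodFin : ∀ n → (Fin n → ℤ) → ℤ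
prodFin zero f = + 1
prodFin (suc n) f = f zero * prodFin n (λ i → f (suc i))

per : ∀ {n} → Matrix n → ℤ
per {n} A = foldr _+_ (+ 0) (map (λ σ → prodFin n (λ i → A i (σ i))) (permutations n))

_∘ₕ_ : ∀ {n} → Matrix n → Matrix n → Matrix n
(A ∘ₕ B) i j = A i j * B i j

adjK : ∀ n → Matrix n
adjK n i j with i ≟ j
... | yes _ = + 0
... | no  _ = + 1

degree : ∀ {n} → Matrix n → Fin n → ℤ
degree {n} A i = sumFin n (A i)
  where
  sumFin : ∀ m → (Fin m → ℤ) → ℤ
  sumFin zero f = + 0
  sumFin (suc m) f = f zero + sumFin m (λ k → f (suc k))

laplacian : ∀ {n} → Matrix n → Matrix n
laplacian A i j with i ≟ j
... | yes _ = degree A i - A i j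
... | no  _ = Data.Integer.-_ (A i j)
  where import Data.Integer

LK : ∀ n → Matrix n
LK n = laplacian (adjK n)

-- Write L = n I − J for the Laplacian of K_n, so that L ∘ L = J + n (n − 2) I.  Summing over
-- injections row by row gives per (e J + c I) = ∑ⱼ e ^ j n (n − 1) ⋯ (n − j + 1) c ^ (n − j);
-- hence per L = ∑ⱼ (−1) ^ j uⱼ with uⱼ = n (n − 1) ⋯ (n − j + 1) n ^ (n − j), and per (L ∘ L) = ∑ⱼ tⱼ
-- with (n − 2) tⱼ₊₁ ≤ tⱼ, a geometric tail: (n − 3) per (L ∘ L) ≤ (n − 2) n ^ n (n − 2) ^ n.
-- Pairing neighbouring terms, 2 n per L = n ^ (n + 1) + ∑ⱼ (−1) ^ j j uⱼ, where j uⱼ is unimodal and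
-- bounded by n ^ (n + 1) / 5 for n ≥ 16, so 5 per L ≥ 2 n ^ n.  Since five terms of the binomial
-- expansion of (1 + 2 / (n − 2)) ^ n already exceed 7, (n − 2) ^ n ≤ n ^ n / 7, and the three bounds
-- give per (L ∘ L) ≤ (per L) ^ 2 for n ≥ 16.  The cases n < 16 are computed.

module Submission where

open import Defs
open import Data.Nat using (ℕ; _≥_)
open import Data.Integer using (_≤_; _*_)

open import Data.Bool using (true; false; if_then_else_)
open import Data.Nat as ℕ using (zero; suc; _∸_; z≤n; s≤s)
import Data.Nat.Properties as ℕ
open import Data.Nat.Combinatorics using (_C_; k>n⇒nCk≡0; nCk+nC[k+1]≡[n+1]C[k+1])
open import Data.Integer using (ℤ; +_; -_; _+_; _-_; _^_; _<_; +≤+; +<+; nonNegative; positive)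
open import Data.Integer.Properties
  using ( +-*-semiring; ≤-refl; ≤-trans; ≤-reflexive; ≤-total; _≤?_; ≰⇒>; <⇒≱; module ≤-Reasoning
        ; *-identityˡ; *-identityʳ; *-zeroʳ; *-assoc; *-distribˡ-+; +-identityˡ; +-identityʳ
        ; +-mono-≤; +-monoʳ-≤; neg-mono-≤; *-monoˡ-≤-nonNeg; *-monoʳ-≤-nonNeg; *-cancelˡ-≤-pos
        ; i≤j⇒0≤j-i; 0≤i-j⇒j≤i; i≤j⇒i-j≤0; i-j≤0⇒i≤j; pos-*; ^-zeroˡ )
open import Data.Integer.Tactic.RingSolver using (solve-∀)
open import Data.Fin using (Fin; zero; suc; toℕ; fromℕ<; punchIn; punchOut; _≟_)
import Data.Fin.Properties
open Data.Fin.Properties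
  using (toℕ-fromℕ<; 0≢1+n; suc-injective; punchInᵢ≢i; punchIn-injective; punchIn-punchOut; punchOut-injective)
open import Data.List as List using (List; []; _∷_; foldr; filter; concatMap; _++_)
open import Data.List.Properties using (map-cong; map-∘)
open import Data.Vec as Vec using (Vec; []; _∷_; tabulate)
open import Data.Vec.Properties using (lookup∘tabulate)
open import Data.Vec.Relation.Unary.All as All using (All; []; _∷_; all?)
import Data.Vec.Relation.Unary.All.Properties as All
open import Data.Vec.Relation.Unary.AllPairs using (allPairs?)
open import Data.Vec.Relation.Unary.Unique.Propositional using (Unique; []; _∷_)
open import Data.Vec.Relation.Unary.Unique.Propositional.Properties using (tabulate⁺; lookup-injective)
open import Algebra.Properties.Semiring.Sum +-*-semiring
  using (sum; sum-syntax; sum-cong-≗; ∑-distrib-+; *-distribˡ-sum; sum-remove; sum-replicate-zero)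
open import Data.Product using (_×_; _,_; proj₁)
open import Data.Sum using (inj₁; inj₂)
open import Data.Unit using (tt)
open import Function using (_∘_; id; _⇔_; mk⇔; Equivalence)
open import Function.Definitions using (Injective)
open import Relation.Nullary using (Dec; yes; no; does; ¬_; ¬?; _×-dec_; contradiction)
open import Relation.Nullary.Decidable using (toWitness)
open import Relation.Binary.PropositionalEquality
  using (_≡_; _≢_; refl; sym; trans; cong; cong₂; subst; subst₂; module ≡-Reasoning)

𝟙 : ∀ {p} {P : Set p} → Dec P → ℤ
𝟙 P? = if does P? then + 1 else + 0

module _ {p} {P : Set p} where

  𝟙-yes : (P? : Dec P) → P → 𝟙 P? ≡ + 1
  𝟙-yes (yes _) _ = refl
  𝟙-yes (no ¬p) p = contradiction p ¬p

  𝟙-no : (P? : Dec P) → ¬ P → 𝟙 P? ≡ + 0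
  𝟙-no (yes p) ¬p = contradiction p ¬p
  𝟙-no (no _)  _  = refl

  𝟙-¬ : (P? : Dec P) → 𝟙 (¬? P?) ≡ + 1 - 𝟙 P?
  𝟙-¬ (yes _) = refl
  𝟙-¬ (no _)  = refl

  𝟙-idem : (P? : Dec P) → 𝟙 P? * 𝟙 P? ≡ 𝟙 P?
  𝟙-idem (yes _) = refl
  𝟙-idem (no _)  = refl

module _ {p q} {P : Set p} {Q : Set q} where

  𝟙-⇔ : (P? : Dec P) (Q? : Dec Q) → P ⇔ Q → 𝟙 P? ≡ 𝟙 Q?
  𝟙-⇔ (yes p) Q? P⇔Q = sym (𝟙-yes Q? (Equivalence.to P⇔Q p))
  𝟙-⇔ (no ¬p) Q? P⇔Q = sym (𝟙-no Q? (¬p ∘ Equivalence.from P⇔Q))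

  𝟙-× : (P? : Dec P) (Q? : Dec Q) → 𝟙 (P? ×-dec Q?) ≡ 𝟙 P? * 𝟙 Q?
  𝟙-× (yes _) (yes _) = refl
  𝟙-× (yes _) (no _)  = refl
  𝟙-× (no _)  _       = refl

∑ᴸ : ∀ {a} {A : Set a} → List A → (A → ℤ) → ℤ
∑ᴸ xs g = foldr _+_ (+ 0) (List.map g xs)

module _ {a} {A : Set a} where

  ∑ᴸ-cong : ∀ (xs : List A) {g h : A → ℤ} → (∀ x → g x ≡ h x) → ∑ᴸ xs g ≡ ∑ᴸ xs h
  ∑ᴸ-cong xs g≗h = cong (foldr _+_ (+ 0)) (map-cong g≗h xs)

  ∑ᴸ-++ : ∀ (xs ys : List A) g → ∑ᴸ (xs ++ ys) g ≡ ∑ᴸ xs g + ∑ᴸ ys g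
  ∑ᴸ-++ []       ys g = sym (+-identityˡ _)
  ∑ᴸ-++ (x ∷ xs) ys g = trans (cong (_+_ (g x)) (∑ᴸ-++ xs ys g)) (assoc (g x) _ _)
    where
    assoc : ∀ a b c → a + (b + c) ≡ a + b + c
    assoc = solve-∀

  ∑ᴸ-filter : ∀ {P : A → Set} (P? : ∀ x → Dec (P x)) xs g →
              ∑ᴸ (filter P? xs) g ≡ ∑ᴸ xs (λ x → 𝟙 (P? x) * g x)
  ∑ᴸ-filter P? []       g = refl
  ∑ᴸ-filter P? (x ∷ xs) g with does (P? x)
  ... | true  = cong₂ _+_ (sym (*-identityˡ (g x))) (∑ᴸ-filter P? xs g)
  ... | false = trans (∑ᴸ-filter P? xs g) (sym (+-identityˡ _))

  ∑ᴸ-tabulate : ∀ {m} (f : Fin m → A) g → ∑ᴸ (List.tabulate f) g ≡ ∑[ j < m ] g (f j)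
  ∑ᴸ-tabulate {zero}  f g = refl
  ∑ᴸ-tabulate {suc m} f g = cong (_+_ (g (f zero))) (∑ᴸ-tabulate (f ∘ suc) g)

  module _ {b} {B : Set b} where

    ∑ᴸ-map : ∀ (f : B → A) xs g → ∑ᴸ (List.map f xs) g ≡ ∑ᴸ xs (g ∘ f)
    ∑ᴸ-map f xs g = cong (foldr _+_ (+ 0)) (sym (map-∘ xs))

    ∑ᴸ-concatMap : ∀ (f : B → List A) xs g → ∑ᴸ (concatMap f xs) g ≡ ∑ᴸ xs (λ x → ∑ᴸ (f x) g)
    ∑ᴸ-concatMap f []       g = refl
    ∑ᴸ-concatMap f (x ∷ xs) g =
      trans (∑ᴸ-++ (f x) (concatMap f xs) g) (cong (_+_ (∑ᴸ (f x) g)) (∑ᴸ-concatMap f xs g))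

∑-linear : ∀ {m} a b (f g : Fin m → ℤ) →
           ∑[ j < m ] (a * f j + b * g j) ≡ a * ∑[ j < m ] f j + b * ∑[ j < m ] g j
∑-linear a b f g = trans (∑-distrib-+ (λ j → a * f j) (λ j → b * g j))
                         (sym (cong₂ _+_ (*-distribˡ-sum a f) (*-distribˡ-sum b g)))

∑-one : ∀ m → ∑[ j < m ] (+ 1) ≡ + m
∑-one zero    = refl
∑-one (suc m) = cong (_+_ (+ 1)) (∑-one m)

∑-𝟙≟ : ∀ {m} (k : Fin m) (φ : Fin m → ℤ) → ∑[ j < m ] (𝟙 (j ≟ k) * φ j) ≡ φ k
∑-𝟙≟ {suc m} k φ = begin
  ∑[ j < suc m ] (𝟙 (j ≟ k) * φ j)
    ≡⟨ sum-remove {i = k} (λ j → 𝟙 (j ≟ k) * φ j) ⟩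
  𝟙 (k ≟ k) * φ k + ∑[ l < m ] (𝟙 (punchIn k l ≟ k) * φ (punchIn k l))
    ≡⟨ cong₂ _+_ (cong (_* φ k) (𝟙-yes (k ≟ k) refl))
                 (trans (sum-cong-≗ (λ l → cong (_* φ (punchIn k l)) (𝟙-no (punchIn k l ≟ k) (punchInᵢ≢i k l))))
                        (sum-replicate-zero m)) ⟩
  + 1 * φ k + + 0
    ≡⟨ unit (φ k) ⟩
  φ k ∎
  where
  open ≡-Reasoning
  unit : ∀ x → + 1 * x + + 0 ≡ x
  unit = solve-∀

∑-punchIn : ∀ {m} (p : Fin (suc m)) (φ : Fin (suc m) → ℤ) →
            ∑[ j < suc m ] ((+ 1 - 𝟙 (p ≟ j)) * φ j) ≡ ∑[ l < m ] φ (punchIn p l)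
∑-punchIn {m} p φ = begin
  ∑[ j < suc m ] ((+ 1 - 𝟙 (p ≟ j)) * φ j)
    ≡⟨ sum-remove {i = p} (λ j → (+ 1 - 𝟙 (p ≟ j)) * φ j) ⟩
  (+ 1 - 𝟙 (p ≟ p)) * φ p + ∑[ l < m ] ((+ 1 - 𝟙 (p ≟ punchIn p l)) * φ (punchIn p l))
    ≡⟨ cong₂ _+_ (cong (λ d → (+ 1 - d) * φ p) (𝟙-yes (p ≟ p) refl))
                 (sum-cong-≗ (λ l → trans (cong (λ d → (+ 1 - d) * φ (punchIn p l))
                                                 (𝟙-no (p ≟ punchIn p l) (punchInᵢ≢i p l ∘ sym)))
                                          (*-identityˡ _))) ⟩
  + 0 + ∑[ l < m ] φ (punchIn p l)
    ≡⟨ +-identityˡ _ ⟩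
  ∑[ l < m ] φ (punchIn p l) ∎
  where open ≡-Reasoning

-- Sums over injections

Fresh : ∀ {m n} → Fin m → Vec (Fin m) n → Set
Fresh j = All (j ≢_)

fresh? : ∀ {m n} (j : Fin m) (v : Vec (Fin m) n) → Dec (Fresh j v)
fresh? j = all? (λ k → ¬? (j ≟ k))

unique? : ∀ {m n} (v : Vec (Fin m) n) → Dec (Unique v)
unique? = allPairs? (λ j k → ¬? (j ≟ k))

module _ {m n : ℕ} where

  𝟙-fresh-∷ : ∀ (j k : Fin m) (v : Vec (Fin m) n) →
              𝟙 (fresh? j (k ∷ v)) ≡ (+ 1 - 𝟙 (j ≟ k)) * 𝟙 (fresh? j v)
  𝟙-fresh-∷ j k v = trans (𝟙-× (¬? (j ≟ k)) (fresh? j v)) (cong (_* 𝟙 (fresh? j v)) (𝟙-¬ (j ≟ k)))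

  𝟙-unique-∷ : ∀ (j : Fin m) (v : Vec (Fin m) n) → 𝟙 (unique? (j ∷ v)) ≡ 𝟙 (fresh? j v) * 𝟙 (unique? v)
  𝟙-unique-∷ j v = 𝟙-× (fresh? j v) (unique? v)

  𝟙-fresh-map : ∀ {k} {f : Fin m → Fin k} → Injective _≡_ _≡_ f → ∀ j (v : Vec (Fin m) n) →
                𝟙 (fresh? (f j) (Vec.map f v)) ≡ 𝟙 (fresh? j v)
  𝟙-fresh-map {f = f} f-inj j v = 𝟙-⇔ (fresh? (f j) (Vec.map f v)) (fresh? j v) (mk⇔
    (All.map (λ fj≢fk j≡k → fj≢fk (cong f j≡k)) ∘ All.map⁻)
    (All.map⁺ ∘ All.map (λ j≢k fj≡fk → j≢k (f-inj fj≡fk))))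

-- The sum of G over the injective vectors, i.e. over the injections Fin n → Fin m.
∑inj : ∀ n m → (Vec (Fin m) n → ℤ) → ℤ
∑inj zero    m G = G []
∑inj (suc n) m G = ∑inj n m (λ v → ∑[ j < m ] (𝟙 (fresh? j v) * G (j ∷ v)))

∑inj-cong : ∀ n m {G H : Vec (Fin m) n → ℤ} → (∀ {v} → Unique v → G v ≡ H v) → ∑inj n m G ≡ ∑inj n m H
∑inj-cong zero    m G≈H = G≈H []
∑inj-cong (suc n) m {G} {H} G≈H = ∑inj-cong n m (λ u → sum-cong-≗ (λ j → entry j u))
  where
  entry : ∀ {v} j → Unique v → 𝟙 (fresh? j v) * G (j ∷ v) ≡ 𝟙 (fresh? j v) * H (j ∷ v)
  entry {v} j u with fresh? j v
  ... | yes j∉v = cong (_*_ (+ 1)) (G≈H (j∉v ∷ u))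
  ... | no  _   = refl

∑inj-linear : ∀ n m a b (G H : Vec (Fin m) n → ℤ) →
              ∑inj n m (λ v → a * G v + b * H v) ≡ a * ∑inj n m G + b * ∑inj n m H
∑inj-linear zero    m a b G H = refl
∑inj-linear (suc n) m a b G H =
  trans (∑inj-cong n m (λ {v} _ → trans (sum-cong-≗ (λ j → distrib (𝟙 (fresh? j v)) a b (G (j ∷ v)) (H (j ∷ v))))
                                        (∑-linear a b (λ j → 𝟙 (fresh? j v) * G (j ∷ v))
                                                      (λ j → 𝟙 (fresh? j v) * H (j ∷ v)))))
        (∑inj-linear n m a b (λ v → ∑[ j < m ] (𝟙 (fresh? j v) * G (j ∷ v)))
                             (λ v → ∑[ j < m ] (𝟙 (fresh? j v) * H (j ∷ v))))
  where
  distrib : ∀ x a b g h → x * (a * g + b * h) ≡ a * (x * g) + b * (x * h)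
  distrib = solve-∀

∑-𝟙-fresh : ∀ {m n} {v : Vec (Fin m) n} → Unique v → ∑[ j < m ] 𝟙 (fresh? j v) ≡ + m - + n
∑-𝟙-fresh {m} [] = trans (∑-one m) (sym (+-identityʳ (+ m)))
∑-𝟙-fresh {m} {suc n} {k ∷ v} (k∉v ∷ u) = begin
  ∑[ j < m ] 𝟙 (fresh? j (k ∷ v))
    ≡⟨ sum-cong-≗ (λ j → trans (𝟙-fresh-∷ j k v) (split (𝟙 (j ≟ k)) (𝟙 (fresh? j v)))) ⟩
  ∑[ j < m ] (+ 1 * 𝟙 (fresh? j v) + - + 1 * (𝟙 (j ≟ k) * 𝟙 (fresh? j v)))
    ≡⟨ ∑-linear (+ 1) (- + 1) (λ j → 𝟙 (fresh? j v)) (λ j → 𝟙 (j ≟ k) * 𝟙 (fresh? j v)) ⟩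
  + 1 * ∑[ j < m ] 𝟙 (fresh? j v) + - + 1 * ∑[ j < m ] (𝟙 (j ≟ k) * 𝟙 (fresh? j v))
    ≡⟨ cong₂ (λ s t → + 1 * s + - + 1 * t) (∑-𝟙-fresh u) (trans (∑-𝟙≟ k (λ j → 𝟙 (fresh? j v))) (𝟙-yes (fresh? k v) k∉v)) ⟩
  + 1 * (+ m - + n) + - + 1 * + 1
    ≡⟨ count (+ m) (+ n) ⟩
  + m - + suc n ∎
  where
  open ≡-Reasoning
  split : ∀ d f → (+ 1 - d) * f ≡ + 1 * f + - + 1 * (d * f)
  split = solve-∀
  count : ∀ m n → + 1 * (m - n) + - + 1 * + 1 ≡ m - (+ 1 + n)
  count = solve-∀

∑inj-avoiding : ∀ n m (p : Fin (suc m)) (K : Vec (Fin (suc m)) n → ℤ) →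
             ∑inj n (suc m) (λ τ → 𝟙 (fresh? p τ) * K τ) ≡ ∑inj n m (λ ρ → K (Vec.map (punchIn p) ρ))
∑inj-avoiding zero    m p K = *-identityˡ (K [])
∑inj-avoiding (suc n) m p K = begin
  ∑inj n (suc m) (λ τ → ∑[ j < suc m ] (𝟙 (fresh? j τ) * (𝟙 (fresh? p (j ∷ τ)) * K (j ∷ τ))))
    ≡⟨ ∑inj-cong n (suc m) (λ {τ} _ → factor τ) ⟩
  ∑inj n (suc m) (λ τ → 𝟙 (fresh? p τ) * K′ τ)
    ≡⟨ ∑inj-avoiding n m p K′ ⟩
  ∑inj n m (λ ρ → K′ (Vec.map (punchIn p) ρ))
    ≡⟨ ∑inj-cong n m (λ {ρ} _ → unpunch ρ) ⟩
  ∑inj n m (λ ρ → ∑[ l < m ] (𝟙 (fresh? l ρ) * K (punchIn p l ∷ Vec.map (punchIn p) ρ))) ∎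
  where
  open ≡-Reasoning
  K′ : Vec (Fin (suc m)) n → ℤ
  K′ τ = ∑[ j < suc m ] ((+ 1 - 𝟙 (p ≟ j)) * (𝟙 (fresh? j τ) * K (j ∷ τ)))
  rearrange : ∀ f d q k → f * ((d * q) * k) ≡ q * (d * (f * k))
  rearrange = solve-∀
  factor : ∀ τ → ∑[ j < suc m ] (𝟙 (fresh? j τ) * (𝟙 (fresh? p (j ∷ τ)) * K (j ∷ τ))) ≡ 𝟙 (fresh? p τ) * K′ τ
  factor τ = trans (sum-cong-≗ (λ j → trans (cong (λ x → 𝟙 (fresh? j τ) * (x * K (j ∷ τ))) (𝟙-fresh-∷ p j τ))
                                            (rearrange (𝟙 (fresh? j τ)) (+ 1 - 𝟙 (p ≟ j)) (𝟙 (fresh? p τ)) (K (j ∷ τ)))))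
                   (sym (*-distribˡ-sum (𝟙 (fresh? p τ)) (λ j → (+ 1 - 𝟙 (p ≟ j)) * (𝟙 (fresh? j τ) * K (j ∷ τ)))))
  unpunch : ∀ ρ → K′ (Vec.map (punchIn p) ρ) ≡ ∑[ l < m ] (𝟙 (fresh? l ρ) * K (punchIn p l ∷ Vec.map (punchIn p) ρ))
  unpunch ρ = trans (∑-punchIn p (λ j → 𝟙 (fresh? j (Vec.map (punchIn p) ρ)) * K (j ∷ Vec.map (punchIn p) ρ)))
    (sum-cong-≗ (λ l → cong (_* K (punchIn p l ∷ Vec.map (punchIn p) ρ))
                            (𝟙-fresh-map (λ {x} {y} → punchIn-injective p x y) l ρ)))

-- Weights are applied to tabulate f: on the functions built by allFuns this reduces to j ∷ tabulate f,
-- so no function extensionality is needed.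
∑ᴸ-allFuns-suc : ∀ n m (H : Vec (Fin m) (suc n) → ℤ) →
                 ∑ᴸ (allFuns (suc n) m) (H ∘ tabulate) ≡ ∑ᴸ (allFuns n m) (λ f → ∑[ j < m ] H (j ∷ tabulate f))
∑ᴸ-allFuns-suc n m H = trans (∑ᴸ-concatMap _ (allFuns n m) (H ∘ tabulate))
  (∑ᴸ-cong (allFuns n m) (λ f → trans (∑ᴸ-map _ (List.allFin m) (H ∘ tabulate)) (∑ᴸ-tabulate id (λ j → H (j ∷ tabulate f)))))

∑ᴸ-allFuns : ∀ n m (G : Vec (Fin m) n → ℤ) →
             ∑ᴸ (allFuns n m) (λ f → 𝟙 (unique? (tabulate f)) * G (tabulate f)) ≡ ∑inj n m G
∑ᴸ-allFuns zero    m G = unit (G [])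
  where
  unit : ∀ x → + 1 * x + + 0 ≡ x
  unit = solve-∀
∑ᴸ-allFuns (suc n) m G = begin
  ∑ᴸ (allFuns (suc n) m) (λ f → 𝟙 (unique? (tabulate f)) * G (tabulate f))
    ≡⟨ ∑ᴸ-allFuns-suc n m (λ v → 𝟙 (unique? v) * G v) ⟩
  ∑ᴸ (allFuns n m) (λ f → ∑[ j < m ] (𝟙 (unique? (j ∷ tabulate f)) * G (j ∷ tabulate f)))
    ≡⟨ ∑ᴸ-cong (allFuns n m) (λ f → pull (tabulate f)) ⟩
  ∑ᴸ (allFuns n m) (λ f → 𝟙 (unique? (tabulate f)) * ∑[ j < m ] (𝟙 (fresh? j (tabulate f)) * G (j ∷ tabulate f)))
    ≡⟨ ∑ᴸ-allFuns n m _ ⟩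
  ∑inj (suc n) m G ∎
  where
  open ≡-Reasoning
  swap : ∀ f u g → f * u * g ≡ u * (f * g)
  swap = solve-∀
  pull : ∀ v → ∑[ j < m ] (𝟙 (unique? (j ∷ v)) * G (j ∷ v)) ≡ 𝟙 (unique? v) * ∑[ j < m ] (𝟙 (fresh? j v) * G (j ∷ v))
  pull v = trans (sum-cong-≗ (λ j → trans (cong (_* G (j ∷ v)) (𝟙-unique-∷ j v))
                                          (swap (𝟙 (fresh? j v)) (𝟙 (unique? v)) (G (j ∷ v)))))
                 (sym (*-distribˡ-sum (𝟙 (unique? v)) (λ j → 𝟙 (fresh? j v) * G (j ∷ v))))

diagonalProduct : ∀ {n m} → (Fin n → Fin m → ℤ) → Vec (Fin m) n → ℤ
diagonalProduct M []      = + 1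
diagonalProduct M (j ∷ v) = M zero j * diagonalProduct (M ∘ suc) v

prodFin-cong : ∀ n {f g : Fin n → ℤ} → (∀ i → f i ≡ g i) → prodFin n f ≡ prodFin n g
prodFin-cong zero    f≗g = refl
prodFin-cong (suc n) f≗g = cong₂ _*_ (f≗g zero) (prodFin-cong n (f≗g ∘ suc))

prodFin-tabulate : ∀ {n m} (M : Fin n → Fin m → ℤ) (σ : Fin n → Fin m) →
                   prodFin n (λ i → M i (σ i)) ≡ diagonalProduct M (tabulate σ)
prodFin-tabulate {zero}  M σ = refl
prodFin-tabulate {suc n} M σ = cong (_*_ (M zero (σ zero))) (prodFin-tabulate (M ∘ suc) (σ ∘ suc))

per-cong : ∀ {n} {A B : Matrix n} → (∀ i j → A i j ≡ B i j) → per A ≡ per B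
per-cong {n} A≈B = ∑ᴸ-cong (permutations n) (λ σ → prodFin-cong n (λ i → A≈B i (σ i)))

𝟙-injective : ∀ {n} (σ : Fin n → Fin n) → 𝟙 (injective? σ) ≡ 𝟙 (unique? (tabulate σ))
𝟙-injective σ = 𝟙-⇔ (injective? σ) (unique? (tabulate σ)) (mk⇔
  (λ σ-inj → tabulate⁺ (λ {i} {j} → σ-inj i j))
  (λ u i j σi≡σj → lookup-injective u i j
                     (trans (lookup∘tabulate σ i) (trans σi≡σj (sym (lookup∘tabulate σ j))))))

per≡∑inj : ∀ {n} (M : Matrix n) → per M ≡ ∑inj n n (diagonalProduct M)
per≡∑inj {n} M = begin
  per M
    ≡⟨ ∑ᴸ-filter injective? (allFuns n n) (λ σ → prodFin n (λ i → M i (σ i))) ⟩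
  ∑ᴸ (allFuns n n) (λ σ → 𝟙 (injective? σ) * prodFin n (λ i → M i (σ i)))
    ≡⟨ ∑ᴸ-cong (allFuns n n) (λ σ → cong₂ _*_ (𝟙-injective σ) (prodFin-tabulate M σ)) ⟩
  ∑ᴸ (allFuns n n) (λ σ → 𝟙 (unique? (tabulate σ)) * diagonalProduct M (tabulate σ))
    ≡⟨ ∑ᴸ-allFuns n n (diagonalProduct M) ⟩
  ∑inj n n (diagonalProduct M) ∎
  where open ≡-Reasoning

-- Permanents of e J + c P_μ

eJ+cP : ∀ {n m} → ℤ → ℤ → (Fin n → Fin m) → Fin n → Fin m → ℤ
eJ+cP e c μ i j = e + c * 𝟙 (j ≟ μ i)

-- Expanding along the first row: each of the m + 1 − n free columns contributes e,
-- and the column μ 0 contributes c more, the remaining rows then avoiding that column.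
perPattern : ℤ → ℤ → ℕ → ℕ → ℤ
perPattern e c zero    m       = + 1
perPattern e c (suc n) zero    = + 0
perPattern e c (suc n) (suc m) = e * (+ suc m - + n) * perPattern e c n (suc m) + c * perPattern e c n m

diagonalProduct-map : ∀ {n m k} e c {f : Fin m → Fin k} → Injective _≡_ _≡_ f →
                      {μ : Fin n → Fin k} {μ′ : Fin n → Fin m} → (∀ i → μ i ≡ f (μ′ i)) → ∀ ρ →
                      diagonalProduct (eJ+cP e c μ) (Vec.map f ρ) ≡ diagonalProduct (eJ+cP e c μ′) ρ
diagonalProduct-map e c f-inj μ≡ []      = refl
diagonalProduct-map e c {f} f-inj {μ} {μ′} μ≡ (l ∷ ρ) = cong₂ _*_
  (cong (λ x → e + c * x) (𝟙-⇔ (f l ≟ μ zero) (l ≟ μ′ zero) (mk⇔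
    (λ fl≡μ0 → f-inj (trans fl≡μ0 (μ≡ zero)))
    (λ l≡μ′0 → trans (cong f l≡μ′0) (sym (μ≡ zero))))))
  (diagonalProduct-map e c f-inj (μ≡ ∘ suc) ρ)

∑-fresh-row : ∀ {m n} {τ : Vec (Fin m) n} → Unique τ → ∀ e c (k : Fin m) d →
              ∑[ j < m ] (𝟙 (fresh? j τ) * ((e + c * 𝟙 (j ≟ k)) * d)) ≡ e * (+ m - + n) * d + c * (𝟙 (fresh? k τ) * d)
∑-fresh-row {m} {n} {τ} u e c k d = begin
  ∑[ j < m ] (𝟙 (fresh? j τ) * ((e + c * 𝟙 (j ≟ k)) * d))
    ≡⟨ sum-cong-≗ (λ j → expand (𝟙 (fresh? j τ)) e c (𝟙 (j ≟ k)) d) ⟩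
  ∑[ j < m ] (e * d * 𝟙 (fresh? j τ) + c * d * (𝟙 (j ≟ k) * 𝟙 (fresh? j τ)))
    ≡⟨ ∑-linear (e * d) (c * d) (λ j → 𝟙 (fresh? j τ)) (λ j → 𝟙 (j ≟ k) * 𝟙 (fresh? j τ)) ⟩
  e * d * ∑[ j < m ] 𝟙 (fresh? j τ) + c * d * ∑[ j < m ] (𝟙 (j ≟ k) * 𝟙 (fresh? j τ))
    ≡⟨ cong₂ (λ s t → e * d * s + c * d * t) (∑-𝟙-fresh u) (∑-𝟙≟ k (λ j → 𝟙 (fresh? j τ))) ⟩
  e * d * (+ m - + n) + c * d * 𝟙 (fresh? k τ)
    ≡⟨ collect e c d (+ m - + n) (𝟙 (fresh? k τ)) ⟩
  e * (+ m - + n) * d + c * (𝟙 (fresh? k τ) * d) ∎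
  where
  open ≡-Reasoning
  expand : ∀ f e c δ d → f * ((e + c * δ) * d) ≡ e * d * f + c * d * (δ * f)
  expand = solve-∀
  collect : ∀ e c d s f → e * d * s + c * d * f ≡ e * s * d + c * (f * d)
  collect = solve-∀

∑inj-eJ+cP : ∀ e c n m (μ : Fin n → Fin m) → Injective _≡_ _≡_ μ →
             ∑inj n m (diagonalProduct (eJ+cP e c μ)) ≡ perPattern e c n m
∑inj-eJ+cP e c zero    m       μ μ-inj = refl
∑inj-eJ+cP e c (suc n) zero    μ μ-inj with μ zero
... | ()
∑inj-eJ+cP e c (suc n) (suc m) μ μ-inj = begin
  ∑inj n (suc m) (λ τ → ∑[ j < suc m ] (𝟙 (fresh? j τ) * ((e + c * 𝟙 (j ≟ μ zero)) * D τ)))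
    ≡⟨ ∑inj-cong n (suc m) (λ {τ} u → ∑-fresh-row u e c (μ zero) (D τ)) ⟩
  ∑inj n (suc m) (λ τ → e * (+ suc m - + n) * D τ + c * (𝟙 (fresh? (μ zero) τ) * D τ))
    ≡⟨ ∑inj-linear n (suc m) (e * (+ suc m - + n)) c D (λ τ → 𝟙 (fresh? (μ zero) τ) * D τ) ⟩
  e * (+ suc m - + n) * ∑inj n (suc m) D + c * ∑inj n (suc m) (λ τ → 𝟙 (fresh? (μ zero) τ) * D τ)
    ≡⟨ cong₂ (λ x y → e * (+ suc m - + n) * x + c * y)
             (∑inj-eJ+cP e c n (suc m) (μ ∘ suc) (suc-injective ∘ μ-inj)) avoiding-μ0 ⟩
  perPattern e c (suc n) (suc m) ∎
  where
  open ≡-Reasoning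
  D : Vec (Fin (suc m)) n → ℤ
  D = diagonalProduct (eJ+cP e c (μ ∘ suc))
  μ0≢ : ∀ i → μ zero ≢ μ (suc i)
  μ0≢ i = 0≢1+n ∘ μ-inj
  μ′ : Fin n → Fin m
  μ′ i = punchOut (μ0≢ i)
  μ′-inj : Injective _≡_ _≡_ μ′
  μ′-inj = suc-injective ∘ μ-inj ∘ punchOut-injective (μ0≢ _) (μ0≢ _)
  avoiding-μ0 : ∑inj n (suc m) (λ τ → 𝟙 (fresh? (μ zero) τ) * D τ) ≡ perPattern e c n m
  avoiding-μ0 = begin
    ∑inj n (suc m) (λ τ → 𝟙 (fresh? (μ zero) τ) * D τ)
      ≡⟨ ∑inj-avoiding n m (μ zero) D ⟩
    ∑inj n m (λ ρ → D (Vec.map (punchIn (μ zero)) ρ))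
      ≡⟨ ∑inj-cong n m (λ {ρ} _ → diagonalProduct-map e c (λ {x} {y} → punchIn-injective (μ zero) x y)
                                    (λ i → sym (punchIn-punchOut (μ0≢ i))) ρ) ⟩
    ∑inj n m (diagonalProduct (eJ+cP e c μ′))
      ≡⟨ ∑inj-eJ+cP e c n m μ′ μ′-inj ⟩
    perPattern e c n m ∎

∑ₙ : ℕ → (ℕ → ℤ) → ℤ
∑ₙ L x = ∑[ j < L ] x (toℕ j)

∑ₙ-cong : ∀ L {x y : ℕ → ℤ} → (∀ j → x j ≡ y j) → ∑ₙ L x ≡ ∑ₙ L y
∑ₙ-cong L x≗y = sum-cong-≗ (λ (j : Fin L) → x≗y (toℕ j))

∑ₙ-linear : ∀ L a b (x y : ℕ → ℤ) → ∑ₙ L (λ j → a * x j + b * y j) ≡ a * ∑ₙ L x + b * ∑ₙ L y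
∑ₙ-linear L a b x y = ∑-linear a b (λ (j : Fin L) → x (toℕ j)) (λ j → y (toℕ j))

binom : ℤ → ℕ → ℕ → ℤ
binom c n j = + (n C j) * c ^ (n ∸ j)

binom-head : ∀ c n → binom c n 0 ≡ c ^ n
binom-head c n = *-identityˡ (c ^ n)

binom-pascal : ∀ c n j → binom c (suc n) (suc j) ≡ c * binom c n (suc j) + binom c n j
binom-pascal c n j = begin
  + (suc n C suc j) * c ^ (n ∸ j)
    ≡⟨ cong (λ k → + k * c ^ (n ∸ j)) (sym (nCk+nC[k+1]≡[n+1]C[k+1] n j)) ⟩
  (+ (n C j) + + (n C suc j)) * c ^ (n ∸ j)
    ≡⟨ split (+ (n C j)) (+ (n C suc j)) (c ^ (n ∸ j)) ⟩
  + (n C suc j) * c ^ (n ∸ j) + binom c n j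
    ≡⟨ cong (_+ binom c n j) (lower (j ℕ.<? n)) ⟩
  c * binom c n (suc j) + binom c n j ∎
  where
  open ≡-Reasoning
  split : ∀ a b p → (a + b) * p ≡ b * p + a * p
  split = solve-∀
  swap : ∀ a c p → a * (c * p) ≡ c * (a * p)
  swap = solve-∀
  lower : Dec (j ℕ.< n) → + (n C suc j) * c ^ (n ∸ j) ≡ c * binom c n (suc j)
  lower (yes j<n) = trans (cong (λ k → + (n C suc j) * c ^ k) (ℕ.+-∸-assoc 1 j<n))
                          (swap (+ (n C suc j)) c (c ^ (n ∸ suc j)))
  lower (no  j≮n) rewrite k>n⇒nCk≡0 (s≤s (ℕ.≮⇒≥ j≮n)) = sym (*-zeroʳ c)

rising : ℕ → ℕ → ℤ
rising s zero    = + 1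
rising s (suc j) = + suc s * rising (suc s) j

rising-suc : ∀ s j → rising s (suc j) ≡ (+ s + + suc j) * rising s j
rising-suc s zero    = cong (λ k → + k * + 1) (ℕ.+-comm 1 s)
rising-suc s (suc j) = trans (cong (_*_ (+ suc s)) (rising-suc (suc s) j)) (reorder (+ s) (+ j) (rising (suc s) j))
  where
  reorder : ∀ s j r → (+ 1 + s) * ((+ 1 + s + (+ 1 + j)) * r) ≡ (s + (+ 1 + (+ 1 + j))) * ((+ 1 + s) * r)
  reorder = solve-∀

term : ℤ → ℕ → ℕ → ℤ
term c n j = binom c n j * rising 0 j

term-head : ∀ c n → term c n 0 ≡ c ^ n
term-head c n = trans (*-identityʳ (binom c n 0)) (binom-head c n)

term-last : ∀ c n → term c n (suc n) ≡ + 0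
term-last c n rewrite k>n⇒nCk≡0 (ℕ.n<1+n n) = refl

term-suc : ∀ c n j → term c (suc n) (suc j) ≡ c * term c n (suc j) + (+ 1 + + j) * term c n j
term-suc c n j = begin
  binom c (suc n) (suc j) * rising 0 (suc j)
    ≡⟨ cong₂ _*_ (binom-pascal c n j) (rising-suc 0 j) ⟩
  (c * binom c n (suc j) + binom c n j) * ((+ 0 + + suc j) * rising 0 j)
    ≡⟨ cong (λ r → (c * binom c n (suc j) + binom c n j) * r) (sym (rising-suc 0 j)) ⟩
  (c * binom c n (suc j) + binom c n j) * rising 0 (suc j)
    ≡⟨ distrib c (binom c n (suc j)) (binom c n j) (rising 0 (suc j)) ⟩
  c * term c n (suc j) + binom c n j * rising 0 (suc j)
    ≡⟨ cong (λ r → c * term c n (suc j) + binom c n j * r) (rising-suc 0 j) ⟩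
  c * term c n (suc j) + binom c n j * ((+ 0 + + suc j) * rising 0 j)
    ≡⟨ cong (_+_ (c * term c n (suc j))) (swap (binom c n j) (+ j) (rising 0 j)) ⟩
  c * term c n (suc j) + (+ 1 + + j) * term c n j ∎
  where
  open ≡-Reasoning
  distrib : ∀ c a b r → (c * a + b) * r ≡ c * (a * r) + b * r
  distrib = solve-∀
  swap : ∀ b j r → b * ((+ 0 + (+ 1 + j)) * r) ≡ (+ 1 + j) * (b * r)
  swap = solve-∀

term-suc-head : ∀ c n → term c (suc n) 0 ≡ c * term c n 0
term-suc-head c n = trans (term-head c (suc n)) (cong (_*_ c) (sym (term-head c n)))

term-step : ∀ c n j → c * term c n (suc j) ≡ (+ n - + j) * term c n j
term-step c zero    zero    = *-zeroʳ c
term-step c zero    (suc j) = trans (*-zeroʳ c) (sym (*-zeroʳ (+ 0 - + suc j)))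
term-step c (suc n) zero    = begin
  c * term c (suc n) 1
    ≡⟨ cong (_*_ c) (term-suc c n 0) ⟩
  c * (c * term c n 1 + (+ 1 + + 0) * term c n 0)
    ≡⟨ cong (λ t → c * (t + (+ 1 + + 0) * term c n 0)) (term-step c n 0) ⟩
  c * ((+ n - + 0) * term c n 0 + (+ 1 + + 0) * term c n 0)
    ≡⟨ collect c (+ n) (term c n 0) ⟩
  (+ 1 + + n - + 0) * (c * term c n 0)
    ≡⟨ cong (_*_ (+ 1 + + n - + 0)) (sym (term-suc-head c n)) ⟩
  (+ suc n - + 0) * term c (suc n) 0 ∎
  where
  open ≡-Reasoning
  collect : ∀ c n t → c * ((n - + 0) * t + (+ 1 + + 0) * t) ≡ (+ 1 + n - + 0) * (c * t)
  collect = solve-∀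
term-step c (suc n) (suc j) = begin
  c * term c (suc n) (suc (suc j))
    ≡⟨ cong (_*_ c) (term-suc c n (suc j)) ⟩
  c * (c * T₂ + (+ 1 + + suc j) * T₁)
    ≡⟨ cong (λ t → c * (t + (+ 1 + + suc j) * T₁)) (term-step c n (suc j)) ⟩
  c * ((+ n - + suc j) * T₁ + (+ 1 + + suc j) * T₁)
    ≡⟨ regroup c (+ n) (+ j) T₁ ⟩
  (+ n - + j) * (c * T₁) + (+ 1 + + j) * (c * T₁)
    ≡⟨ cong (λ t → (+ n - + j) * (c * T₁) + (+ 1 + + j) * t) (term-step c n j) ⟩
  (+ n - + j) * (c * T₁) + (+ 1 + + j) * ((+ n - + j) * T₀)
    ≡⟨ factor c (+ n) (+ j) T₁ T₀ ⟩
  (+ 1 + + n - (+ 1 + + j)) * (c * T₁ + (+ 1 + + j) * T₀)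
    ≡⟨ cong (_*_ (+ 1 + + n - (+ 1 + + j))) (sym (term-suc c n j)) ⟩
  (+ suc n - + suc j) * term c (suc n) (suc j) ∎
  where
  open ≡-Reasoning
  T₀ = term c n j
  T₁ = term c n (suc j)
  T₂ = term c n (suc (suc j))
  regroup : ∀ c n j t → c * ((n - (+ 1 + j)) * t + (+ 1 + (+ 1 + j)) * t) ≡ (n - j) * (c * t) + (+ 1 + j) * (c * t)
  regroup = solve-∀
  factor : ∀ c n j t₁ t₀ → (n - j) * (c * t₁) + (+ 1 + j) * ((n - j) * t₀) ≡ (+ 1 + n - (+ 1 + j)) * (c * t₁ + (+ 1 + j) * t₀)
  factor = solve-∀

perPattern-closed : ∀ e c n s L → n ℕ.< L →
                    perPattern e c n (n ℕ.+ s) ≡ ∑ₙ L (λ j → binom c n j * e ^ j * rising s j)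
perPattern-closed e c zero    s (suc L) _ = sym (cong (_+_ (+ 1)) (sum-replicate-zero L))
perPattern-closed e c (suc n) s (suc L) (s≤s n<L) = begin
  e * (+ suc (n ℕ.+ s) - + n) * perPattern e c n (suc (n ℕ.+ s)) + c * perPattern e c n (n ℕ.+ s)
    ≡⟨ cong₂ (λ d p → e * d * p + c * perPattern e c n (n ℕ.+ s))
             (gap (+ n) (+ s)) (cong (perPattern e c n) (sym (ℕ.+-suc n s))) ⟩
  e * (+ 1 + + s) * perPattern e c n (n ℕ.+ suc s) + c * perPattern e c n (n ℕ.+ s)
    ≡⟨ cong₂ (λ p q → e * (+ 1 + + s) * p + c * q)
             (perPattern-closed e c n (suc s) L n<L)
             (perPattern-closed e c n s (suc L) (ℕ.m<n⇒m<1+n n<L)) ⟩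
  e * (+ 1 + + s) * ∑ₙ L (λ j → binom c n j * e ^ j * rising (suc s) j)
    + c * (binom c n 0 * + 1 * + 1 + ∑ₙ L (λ j → binom c n (suc j) * e ^ suc j * rising s (suc j)))
    ≡⟨ regroup e c (+ s) (binom c n 0) _ _ ⟩
  c * binom c n 0 * + 1 * + 1
    + (c * ∑ₙ L (λ j → binom c n (suc j) * e ^ suc j * rising s (suc j))
       + e * (+ 1 + + s) * ∑ₙ L (λ j → binom c n j * e ^ j * rising (suc s) j))
    ≡⟨ cong₂ _+_ (cong (λ b → b * + 1 * + 1) (sym (trans (binom-head c (suc n)) (cong (_*_ c) (sym (binom-head c n))))))
                 (sym (∑ₙ-linear L c (e * (+ 1 + + s))
                                         (λ j → binom c n (suc j) * e ^ suc j * rising s (suc j))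
                                         (λ j → binom c n j * e ^ j * rising (suc s) j))) ⟩
  binom c (suc n) 0 * + 1 * + 1
    + ∑ₙ L (λ j → c * (binom c n (suc j) * e ^ suc j * rising s (suc j))
                  + e * (+ 1 + + s) * (binom c n j * e ^ j * rising (suc s) j))
    ≡⟨ cong (_+_ (binom c (suc n) 0 * + 1 * + 1)) (∑ₙ-cong L pascal) ⟩
  ∑ₙ (suc L) (λ j → binom c (suc n) j * e ^ j * rising s j) ∎
  where
  open ≡-Reasoning
  gap : ∀ n s → + 1 + (n + s) - n ≡ + 1 + s
  gap = solve-∀
  regroup : ∀ e c s b S₁ S₂ → e * (+ 1 + s) * S₂ + c * (b * + 1 * + 1 + S₁)
                            ≡ c * b * + 1 * + 1 + (c * S₁ + e * (+ 1 + s) * S₂)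
  regroup = solve-∀
  expand : ∀ e c s b₁ b₀ p r → (c * b₁ + b₀) * (e * p) * ((+ 1 + s) * r)
                              ≡ c * (b₁ * (e * p) * ((+ 1 + s) * r)) + e * (+ 1 + s) * (b₀ * p * r)
  expand = solve-∀
  pascal : ∀ j → c * (binom c n (suc j) * e ^ suc j * rising s (suc j))
                 + e * (+ 1 + + s) * (binom c n j * e ^ j * rising (suc s) j)
               ≡ binom c (suc n) (suc j) * e ^ suc j * rising s (suc j)
  pascal j = sym (trans (cong (λ b → b * e ^ suc j * rising s (suc j)) (binom-pascal c n j))
                        (expand e c (+ s) (binom c n (suc j)) (binom c n j) (e ^ j) (rising (suc s) j)))

permanentFormula : ℤ → ℤ → ℕ → ℤ
permanentFormula e c n = ∑ₙ (suc n) (λ j → e ^ j * term c n j)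

per-eJ+cI : ∀ e c n → per (eJ+cP {n} e c id) ≡ permanentFormula e c n
per-eJ+cI e c n = begin
  per (eJ+cP {n} e c id)
    ≡⟨ per≡∑inj (eJ+cP {n} e c id) ⟩
  ∑inj n n (diagonalProduct (eJ+cP e c id))
    ≡⟨ ∑inj-eJ+cP e c n n id (λ eq → eq) ⟩
  perPattern e c n n
    ≡⟨ cong (perPattern e c n) (sym (ℕ.+-identityʳ n)) ⟩
  perPattern e c n (n ℕ.+ 0)
    ≡⟨ perPattern-closed e c n 0 (suc n) ℕ.≤-refl ⟩
  ∑ₙ (suc n) (λ j → binom c n j * e ^ j * rising 0 j)
    ≡⟨ ∑ₙ-cong (suc n) (λ j → swap (binom c n j) (e ^ j) (rising 0 j)) ⟩
  permanentFormula e c n ∎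
  where
  open ≡-Reasoning
  swap : ∀ b p r → b * p * r ≡ p * (b * r)
  swap = solve-∀

-- The Laplacian of K_n

-- Defs.degree sums with a local function; the degree of a constant-row matrix exposes it one size down.
degree≡∑ : ∀ {n} (A : Matrix n) i → degree A i ≡ ∑[ k < n ] A i k
degree≡∑ {suc zero}    A i = refl
degree≡∑ {suc (suc n)} A i = cong (_+_ (A i zero)) (degree≡∑ {suc n} (λ _ k → A i (suc k)) zero)

adjK-entry : ∀ n (i j : Fin n) → adjK n i j ≡ + 1 - 𝟙 (j ≟ i)
adjK-entry n i j with i ≟ j
... | yes i≡j = cong (_-_ (+ 1)) (sym (𝟙-yes (j ≟ i) (sym i≡j)))
... | no  i≢j = cong (_-_ (+ 1)) (sym (𝟙-no (j ≟ i) (i≢j ∘ sym)))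

degree-adjK : ∀ n (i : Fin n) → degree (adjK n) i ≡ + n - + 1
degree-adjK n i = begin
  degree (adjK n) i
    ≡⟨ degree≡∑ (adjK n) i ⟩
  ∑[ k < n ] adjK n i k
    ≡⟨ sum-cong-≗ (λ k → trans (adjK-entry n i k) (split (𝟙 (k ≟ i)))) ⟩
  ∑[ k < n ] (+ 1 * + 1 + - + 1 * (𝟙 (k ≟ i) * + 1))
    ≡⟨ ∑-linear (+ 1) (- + 1) (λ _ → + 1) (λ k → 𝟙 (k ≟ i) * + 1) ⟩
  + 1 * ∑[ k < n ] (+ 1) + - + 1 * ∑[ k < n ] (𝟙 (k ≟ i) * + 1)
    ≡⟨ cong₂ (λ s t → + 1 * s + - + 1 * t) (∑-one n) (∑-𝟙≟ i (λ _ → + 1)) ⟩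
  + 1 * + n + - + 1 * + 1
    ≡⟨ simplify (+ n) ⟩
  + n - + 1 ∎
  where
  open ≡-Reasoning
  split : ∀ d → + 1 - d ≡ + 1 * + 1 + - + 1 * (d * + 1)
  split = solve-∀
  simplify : ∀ n → + 1 * n + - + 1 * + 1 ≡ n - + 1
  simplify = solve-∀

LK-entry : ∀ n (i j : Fin n) → LK n i j ≡ - + 1 + + n * 𝟙 (j ≟ i)
LK-entry n i j with i ≟ j
... | yes refl = begin
  degree (adjK n) i - adjK n i i
    ≡⟨ cong₂ _-_ (degree-adjK n i) (adjK-entry n i i) ⟩
  + n - + 1 - (+ 1 - 𝟙 (i ≟ i))
    ≡⟨ cong (λ d → + n - + 1 - (+ 1 - d) ) (𝟙-yes (i ≟ i) refl) ⟩
  + n - + 1 - (+ 1 - + 1)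
    ≡⟨ diagonal (+ n) ⟩
  - + 1 + + n * + 1
    ≡⟨ cong (λ d → - + 1 + + n * d) (sym (𝟙-yes (i ≟ i) refl)) ⟩
  - + 1 + + n * 𝟙 (i ≟ i) ∎
  where
  open ≡-Reasoning
  diagonal : ∀ n → n - + 1 - (+ 1 - + 1) ≡ - + 1 + n * + 1
  diagonal = solve-∀
... | no i≢j = begin
  - adjK n i j
    ≡⟨ cong -_ (adjK-entry n i j) ⟩
  - (+ 1 - 𝟙 (j ≟ i))
    ≡⟨ cong (λ d → - (+ 1 - d)) (𝟙-no (j ≟ i) (i≢j ∘ sym)) ⟩
  - (+ 1 - + 0)
    ≡⟨ offDiagonal (+ n) ⟩
  - + 1 + + n * + 0
    ≡⟨ cong (λ d → - + 1 + + n * d) (sym (𝟙-no (j ≟ i) (i≢j ∘ sym))) ⟩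
  - + 1 + + n * 𝟙 (j ≟ i) ∎
  where
  open ≡-Reasoning
  offDiagonal : ∀ n → - (+ 1 - + 0) ≡ - + 1 + n * + 0
  offDiagonal = solve-∀

LK∘LK-entry : ∀ n (i j : Fin n) → (LK n ∘ₕ LK n) i j ≡ + 1 + + n * (+ n - + 2) * 𝟙 (j ≟ i)
LK∘LK-entry n i j = begin
  LK n i j * LK n i j
    ≡⟨ cong₂ _*_ (LK-entry n i j) (LK-entry n i j) ⟩
  (- + 1 + + n * δ) * (- + 1 + + n * δ)
    ≡⟨ expand (+ n) δ ⟩
  + 1 + + n * + n * (δ * δ) - + 2 * + n * δ
    ≡⟨ cong (λ d → + 1 + + n * + n * d - + 2 * + n * δ) (𝟙-idem (j ≟ i)) ⟩
  + 1 + + n * + n * δ - + 2 * + n * δ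
    ≡⟨ collect (+ n) δ ⟩
  + 1 + + n * (+ n - + 2) * δ ∎
  where
  open ≡-Reasoning
  δ = 𝟙 (j ≟ i)
  expand : ∀ n δ → (- + 1 + n * δ) * (- + 1 + n * δ) ≡ + 1 + n * n * (δ * δ) - + 2 * n * δ
  expand = solve-∀
  collect : ∀ n δ → + 1 + n * n * δ - + 2 * n * δ ≡ + 1 + n * (n - + 2) * δ
  collect = solve-∀

per-LK : ∀ n → per (LK n) ≡ permanentFormula (- + 1) (+ n) n
per-LK n = trans (per-cong (LK-entry n)) (per-eJ+cI (- + 1) (+ n) n)

per-LK∘LK : ∀ n → per (LK n ∘ₕ LK n) ≡ permanentFormula (+ 1) (+ n * (+ n - + 2)) n
per-LK∘LK n = trans (per-cong (LK∘LK-entry n)) (per-eJ+cI (+ 1) (+ n * (+ n - + 2)) n)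

-- Estimates for integer sequences

0≤+ : ∀ n → + 0 ≤ + n
0≤+ n = +≤+ z≤n

*-nonNeg : ∀ {a b} → + 0 ≤ a → + 0 ≤ b → + 0 ≤ a * b
*-nonNeg {a} {b} 0≤a 0≤b = subst (_≤ a * b) (*-zeroʳ a) (*-monoˡ-≤-nonNeg a {{nonNegative 0≤a}} 0≤b)

^-nonNeg : ∀ {a} → + 0 ≤ a → ∀ k → + 0 ≤ a ^ k
^-nonNeg 0≤a zero    = 0≤+ 1
^-nonNeg 0≤a (suc k) = *-nonNeg 0≤a (^-nonNeg 0≤a k)

≤-from-gap : ∀ {a b} d → b - a ≡ d → + 0 ≤ d → a ≤ b
≤-from-gap d b-a≡d 0≤d = 0≤i-j⇒j≤i (subst (+ 0 ≤_) (sym b-a≡d) 0≤d)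

cancel-pos : ∀ {k a b} → + 0 < k → k * a ≤ k * b → a ≤ b
cancel-pos {k} {a} {b} 0<k = *-cancelˡ-≤-pos a b k {{positive 0<k}}

scaled-nonNeg : ∀ {k d} → + 0 < k → + 0 ≤ k * d → + 0 ≤ d
scaled-nonNeg {k} {d} 0<k 0≤kd = cancel-pos 0<k (subst (_≤ k * d) (sym (*-zeroʳ k)) 0≤kd)

scaled-nonPos : ∀ {k d} → + 0 < k → k * d ≤ + 0 → d ≤ + 0
scaled-nonPos {k} {d} 0<k kd≤0 = cancel-pos 0<k (subst (k * d ≤_) (sym (*-zeroʳ k)) kd≤0)

term-nonNeg : ∀ {c} → + 0 ≤ c → ∀ n j → + 0 ≤ term c n j
term-nonNeg 0≤c n j = *-nonNeg (*-nonNeg (0≤+ (n C j)) (^-nonNeg 0≤c (n ∸ j))) (rising-nonNeg 0 j)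
  where
  rising-nonNeg : ∀ s j → + 0 ≤ rising s j
  rising-nonNeg s zero    = 0≤+ 1
  rising-nonNeg s (suc j) = *-nonNeg (0≤+ (suc s)) (rising-nonNeg (suc s) j)

Antitone : (ℕ → ℤ) → Set
Antitone x = ∀ j → x (suc j) ≤ x j

-- Unimodality stated without naming the peak.
Unimodal : (ℕ → ℤ) → Set
Unimodal x = ∀ {i} → x (suc i) < x i → ∀ {j} → i ℕ.≤ j → x (suc j) ≤ x j

antitone-≤-head : ∀ {x} → Antitone x → ∀ j → x j ≤ x 0
antitone-≤-head anti zero    = ≤-refl
antitone-≤-head anti (suc j) = ≤-trans (anti j) (antitone-≤-head anti j)

unimodal-by-sign : ∀ {x : ℕ → ℤ} k (g y : ℕ → ℤ) → + 0 < k → (∀ j → + 0 ≤ y j) →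
                   (∀ {i j} → i ℕ.≤ j → g j ≤ g i) → (∀ j → k * (x (suc j) - x j) ≡ g j * y j) →
                   Unimodal x
unimodal-by-sign {x} k g y 0<k 0≤y g-anti Δx {i} xᵢ₊₁<xᵢ {j} i≤j with ≤-total (g j) (+ 0)
... | inj₁ gⱼ≤0 = i-j≤0⇒i≤j (scaled-nonPos 0<k
      (subst (_≤ + 0) (sym (Δx j)) (*-monoʳ-≤-nonNeg (y j) {{nonNegative (0≤y j)}} gⱼ≤0)))
... | inj₂ 0≤gⱼ = contradiction (0≤i-j⇒j≤i (scaled-nonNeg 0<k
      (subst (+ 0 ≤_) (sym (Δx i)) (*-nonNeg (≤-trans 0≤gⱼ (g-anti i≤j)) (0≤y i)))))
      (<⇒≱ xᵢ₊₁<xᵢ)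

alternatingSum : (ℕ → ℤ) → ℕ → ℤ
alternatingSum x zero    = + 0
alternatingSum x (suc L) = x 0 - alternatingSum (x ∘ suc) L

∑ₙ-alternating : ∀ L (x : ℕ → ℤ) → ∑ₙ L (λ j → (- + 1) ^ j * x j) ≡ alternatingSum x L
∑ₙ-alternating zero    x = refl
∑ₙ-alternating (suc L) x = begin
  (- + 1) ^ 0 * x 0 + ∑ₙ L (λ j → (- + 1) ^ suc j * x (suc j))
    ≡⟨ cong (_+_ ((- + 1) ^ 0 * x 0)) (∑ₙ-cong L (λ j → *-assoc (- + 1) ((- + 1) ^ j) (x (suc j)))) ⟩
  (- + 1) ^ 0 * x 0 + ∑ₙ L (λ j → - + 1 * ((- + 1) ^ j * x (suc j)))
    ≡⟨ cong (_+_ ((- + 1) ^ 0 * x 0)) (sym (*-distribˡ-sum (- + 1) (λ (j : Fin L) → (- + 1) ^ toℕ j * x (suc (toℕ j))))) ⟩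
  (- + 1) ^ 0 * x 0 + - + 1 * ∑ₙ L (λ j → (- + 1) ^ j * x (suc j))
    ≡⟨ cong (λ t → (- + 1) ^ 0 * x 0 + - + 1 * t) (∑ₙ-alternating L (x ∘ suc)) ⟩
  + 1 * x 0 + - + 1 * alternatingSum (x ∘ suc) L
    ≡⟨ signs (x 0) (alternatingSum (x ∘ suc) L) ⟩
  x 0 - alternatingSum (x ∘ suc) L ∎
  where
  open ≡-Reasoning
  signs : ∀ a b → + 1 * a + - + 1 * b ≡ a - b
  signs = solve-∀

alternatingSum-cong : ∀ L {x y : ℕ → ℤ} → (∀ j → x j ≡ y j) → alternatingSum x L ≡ alternatingSum y L
alternatingSum-cong zero    x≗y = refl
alternatingSum-cong (suc L) x≗y = cong₂ _-_ (x≗y 0) (alternatingSum-cong L (x≗y ∘ suc))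

alternatingSum-* : ∀ L a (x : ℕ → ℤ) → alternatingSum (λ j → a * x j) L ≡ a * alternatingSum x L
alternatingSum-* zero    a x = sym (*-zeroʳ a)
alternatingSum-* (suc L) a x =
  trans (cong (_-_ (a * x 0)) (alternatingSum-* L a (x ∘ suc))) (distrib a (x 0) (alternatingSum (x ∘ suc) L))
  where
  distrib : ∀ a b c → a * b - a * c ≡ a * (b - c)
  distrib = solve-∀

alternatingSum-differences : ∀ L (x : ℕ → ℤ) → x L ≡ + 0 →
                             + 2 * alternatingSum x L ≡ x 0 + alternatingSum (λ j → x j - x (suc j)) L
alternatingSum-differences zero    x x₀≡0 = sym (trans (+-identityʳ (x 0)) x₀≡0)
alternatingSum-differences (suc L) x x_L≡0 = begin
  + 2 * (x 0 - A)
    ≡⟨ expand (x 0) A ⟩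
  + 2 * x 0 - + 2 * A
    ≡⟨ cong (λ t → + 2 * x 0 - t) (alternatingSum-differences L (x ∘ suc) x_L≡0) ⟩
  + 2 * x 0 - (x 1 + D)
    ≡⟨ regroup (x 0) (x 1) D ⟩
  x 0 + (x 0 - x 1 - D) ∎
  where
  open ≡-Reasoning
  A = alternatingSum (x ∘ suc) L
  D = alternatingSum (λ j → x (suc j) - x (suc (suc j))) L
  expand : ∀ a b → + 2 * (a - b) ≡ + 2 * a - + 2 * b
  expand = solve-∀
  regroup : ∀ a b d → + 2 * a - (b + d) ≡ a + (a - b - d)
  regroup = solve-∀

alternatingSum-antitone : ∀ {x} → Antitone x → (∀ j → + 0 ≤ x j) →
                          ∀ L → + 0 ≤ alternatingSum x L × alternatingSum x L ≤ x 0
alternatingSum-antitone     anti 0≤x zero    = ≤-refl , 0≤x 0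
alternatingSum-antitone {x} anti 0≤x (suc L) with alternatingSum-antitone (anti ∘ suc) (0≤x ∘ suc) L
... | 0≤A , A≤x₁ = i≤j⇒0≤j-i (≤-trans A≤x₁ (anti 0)) , ≤-from-gap _ (gap (x 0) _) 0≤A
  where
  gap : ∀ a b → a - (a - b) ≡ b
  gap = solve-∀

alternatingSum-unimodal : ∀ {x M} → Unimodal x → (∀ j → + 0 ≤ x j) → (∀ j → x j ≤ M) →
                          ∀ L → x 0 - M ≤ alternatingSum x L × alternatingSum x L ≤ M
alternatingSum-unimodal {x} {M} uni 0≤x x≤M zero = i≤j⇒i-j≤0 (x≤M 0) , ≤-trans (0≤x 0) (x≤M 0)
alternatingSum-unimodal {x} {M} uni 0≤x x≤M (suc L) with x 0 ≤? x 1
... | yes x₀≤x₁ with alternatingSum-unimodal (λ lt i≤j → uni lt (s≤s i≤j)) (0≤x ∘ suc) (x≤M ∘ suc) L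
...   | x₁-M≤A , A≤M =
  ≤-from-gap _ (lower-gap (x 0) M A) (i≤j⇒0≤j-i A≤M) ,
  ≤-from-gap _ (upper-gap (x 0) (x 1) M A) (+-mono-≤ (i≤j⇒0≤j-i x₁-M≤A) (i≤j⇒0≤j-i x₀≤x₁))
  where
  A = alternatingSum (x ∘ suc) L
  lower-gap : ∀ a m s → a - s - (a - m) ≡ m - s
  lower-gap = solve-∀
  upper-gap : ∀ a b m s → m - (a - s) ≡ (s - (b - m)) + (b - a)
  upper-gap = solve-∀
alternatingSum-unimodal {x} {M} uni 0≤x x≤M (suc L)
    | no x₀≰x₁ with alternatingSum-antitone (λ j → uni (≰⇒> x₀≰x₁) z≤n) 0≤x (suc L)
...   | 0≤S , S≤x₀ = ≤-trans (i≤j⇒i-j≤0 (x≤M 0)) 0≤S , ≤-trans S≤x₀ (x≤M 0)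

geometric-bound : ∀ {r} {t : ℕ → ℤ} → + 0 ≤ r → (∀ j → + 0 ≤ t j) → (∀ j → r * t (suc j) ≤ t j) →
                  ∀ L → (r - + 1) * ∑ₙ L t ≤ r * t 0
geometric-bound {r} {t} 0≤r 0≤t ratio zero = subst (_≤ r * t 0) (sym (*-zeroʳ (r - + 1))) (*-nonNeg 0≤r (0≤t 0))
geometric-bound {r} {t} 0≤r 0≤t ratio (suc L) = begin
  (r - + 1) * (t 0 + ∑ₙ L (t ∘ suc))
    ≡⟨ distrib (r - + 1) (t 0) _ ⟩
  (r - + 1) * t 0 + (r - + 1) * ∑ₙ L (t ∘ suc)
    ≤⟨ +-monoʳ-≤ ((r - + 1) * t 0) (geometric-bound 0≤r (0≤t ∘ suc) (ratio ∘ suc) L) ⟩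
  (r - + 1) * t 0 + r * t 1
    ≤⟨ +-monoʳ-≤ ((r - + 1) * t 0) (ratio 0) ⟩
  (r - + 1) * t 0 + t 0
    ≡⟨ collect r (t 0) ⟩
  r * t 0 ∎
  where
  open ≤-Reasoning
  distrib : ∀ a b c → a * (b + c) ≡ a * b + a * c
  distrib = solve-∀
  collect : ∀ r t → (r - + 1) * t + t ≡ r * t
  collect = solve-∀

-- 24 ∑_{k ≤ 4} C(N, k) a ^ (4 − k) b ^ k: the first five terms of the binomial expansion of
-- (a + b) ^ N, divided by a ^ (N − 4).
binomialHead : ℤ → ℤ → ℕ → ℤ
binomialHead a b N =
  + 24 * (a * a * a * a) + + 24 * n * b * (a * a * a) + + 12 * n * (n - + 1) * (b * b) * (a * a)
    + + 4 * n * (n - + 1) * (n - + 2) * (b * b * b) * a + n * (n - + 1) * (n - + 2) * (n - + 3) * (b * b * b * b)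
  where n = + N

fallingFactorial4-nonNeg : ∀ N → + 0 ≤ + N * (+ N - + 1) * (+ N - + 2) * (+ N - + 3)
fallingFactorial4-nonNeg 0 = 0≤+ 0
fallingFactorial4-nonNeg 1 = 0≤+ 0
fallingFactorial4-nonNeg 2 = 0≤+ 0
fallingFactorial4-nonNeg 3 = 0≤+ 0
fallingFactorial4-nonNeg (suc (suc (suc (suc k)))) =
  *-nonNeg (*-nonNeg (*-nonNeg (0≤+ (4 ℕ.+ k)) (0≤+ (3 ℕ.+ k))) (0≤+ (2 ℕ.+ k))) (0≤+ (1 ℕ.+ k))

binomialHead-≤ : ∀ {a b} → + 0 ≤ a → + 0 ≤ b →
                 ∀ N → a ^ N * binomialHead a b N ≤ + 24 * (a * a * a * a) * (a + b) ^ N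
binomialHead-≤ {a} {b} 0≤a 0≤b zero = ≤-reflexive (base a b)
  where
  base : ∀ a b → + 1 * (+ 24 * (a * a * a * a) + + 24 * + 0 * b * (a * a * a)
                         + + 12 * + 0 * (+ 0 - + 1) * (b * b) * (a * a)
                         + + 4 * + 0 * (+ 0 - + 1) * (+ 0 - + 2) * (b * b * b) * a
                         + + 0 * (+ 0 - + 1) * (+ 0 - + 2) * (+ 0 - + 3) * (b * b * b * b))
                 ≡ + 24 * (a * a * a * a) * + 1
  base = solve-∀
binomialHead-≤ {a} {b} 0≤a 0≤b (suc N) = begin
  a * a ^ N * binomialHead a b (suc N)
    ≡⟨ pascal a b (+ N) (a ^ N) ⟩
  (a + b) * (a ^ N * binomialHead a b N) - a ^ N * (b * b * b * b * b) * (n * (n - + 1) * (n - + 2) * (n - + 3))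
    ≤⟨ ≤-from-gap _ (drop ((a + b) * (a ^ N * binomialHead a b N)) _)
                  (*-nonNeg (*-nonNeg (^-nonNeg 0≤a N) 0≤b⁵) (fallingFactorial4-nonNeg N)) ⟩
  (a + b) * (a ^ N * binomialHead a b N)
    ≤⟨ *-monoˡ-≤-nonNeg (a + b) {{nonNegative (+-mono-≤ 0≤a 0≤b)}} (binomialHead-≤ 0≤a 0≤b N) ⟩
  (a + b) * (+ 24 * (a * a * a * a) * (a + b) ^ N)
    ≡⟨ reorder (a + b) (a * a * a * a) ((a + b) ^ N) ⟩
  + 24 * (a * a * a * a) * ((a + b) * (a + b) ^ N) ∎
  where
  open ≤-Reasoning
  n = + N
  0≤b⁵ : + 0 ≤ b * b * b * b * b
  0≤b⁵ = *-nonNeg (*-nonNeg (*-nonNeg (*-nonNeg 0≤b 0≤b) 0≤b) 0≤b) 0≤b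
  pascal : ∀ a b n p → a * p * (+ 24 * (a * a * a * a) + + 24 * (+ 1 + n) * b * (a * a * a)
                                 + + 12 * (+ 1 + n) * ((+ 1 + n) - + 1) * (b * b) * (a * a)
                                 + + 4 * (+ 1 + n) * ((+ 1 + n) - + 1) * ((+ 1 + n) - + 2) * (b * b * b) * a
                                 + (+ 1 + n) * ((+ 1 + n) - + 1) * ((+ 1 + n) - + 2) * ((+ 1 + n) - + 3) * (b * b * b * b))
           ≡ (a + b) * (p * (+ 24 * (a * a * a * a) + + 24 * n * b * (a * a * a)
                            + + 12 * n * (n - + 1) * (b * b) * (a * a)
                            + + 4 * n * (n - + 1) * (n - + 2) * (b * b * b) * a
                            + n * (n - + 1) * (n - + 2) * (n - + 3) * (b * b * b * b)))
             - p * (b * b * b * b * b) * (n * (n - + 1) * (n - + 2) * (n - + 3))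
  pascal = solve-∀
  drop : ∀ x y → x - (x - y) ≡ y
  drop = solve-∀
  reorder : ∀ s q p → s * (+ 24 * q * p) ≡ + 24 * q * (s * p)
  reorder = solve-∀

7*[n-2]^n≤n^n : ∀ n → 3 ℕ.≤ n → + 7 * (+ n - + 2) ^ n ≤ (+ n) ^ n
7*[n-2]^n≤n^n 0 ()
7*[n-2]^n≤n^n 1 (s≤s ())
7*[n-2]^n≤n^n 2 (s≤s (s≤s ()))
7*[n-2]^n≤n^n n@(suc (suc (suc k))) _ = cancel-pos {+ 24 * r⁴} (+<+ (s≤s z≤n)) (begin
  + 24 * r⁴ * (+ 7 * r ^ n)
    ≡⟨ reorder r⁴ (r ^ n) ⟩
  r ^ n * (+ 168 * r⁴)
    ≤⟨ *-monoˡ-≤-nonNeg (r ^ n) {{nonNegative (^-nonNeg (0≤+ (suc k)) n)}}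
         (≤-from-gap _ (head-gap r) (+-mono-≤ (+-mono-≤ (*-nonNeg (0≤+ 368) r³≥0) (*-nonNeg (0≤+ 112) r²≥0))
                                               (*-nonNeg (0≤+ 32) (*-nonNeg (0≤+ (suc k)) (0≤+ k))))) ⟩
  r ^ n * binomialHead r (+ 2) n
    ≤⟨ binomialHead-≤ (0≤+ (suc k)) (0≤+ 2) n ⟩
  + 24 * r⁴ * (r + + 2) ^ n
    ≡⟨ cong (λ m → + 24 * r⁴ * (+ m) ^ n) (ℕ.+-comm (suc k) 2) ⟩
  + 24 * r⁴ * (+ n) ^ n ∎)
  where
  open ≤-Reasoning
  r = + suc k
  r⁴ = r * r * r * r
  r²≥0 = *-nonNeg (0≤+ (suc k)) (0≤+ (suc k))
  r³≥0 = *-nonNeg r²≥0 (0≤+ (suc k))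
  reorder : ∀ q p → + 24 * q * (+ 7 * p) ≡ p * (+ 168 * q)
  reorder = solve-∀
  head-gap : ∀ r → (+ 24 * (r * r * r * r) + + 24 * (+ 2 + r) * + 2 * (r * r * r)
                     + + 12 * (+ 2 + r) * ((+ 2 + r) - + 1) * (+ 2 * + 2) * (r * r)
                     + + 4 * (+ 2 + r) * ((+ 2 + r) - + 1) * ((+ 2 + r) - + 2) * (+ 2 * + 2 * + 2) * r
                     + (+ 2 + r) * ((+ 2 + r) - + 1) * ((+ 2 + r) - + 2) * ((+ 2 + r) - + 3) * (+ 2 * + 2 * + 2 * + 2)) - + 168 * (r * r * r * r)
           ≡ + 368 * (r * r * r) + + 112 * (r * r) + + 32 * (r * (r - + 1))
  head-gap = solve-∀

^-distribʳ-* : ∀ a b k → (a * b) ^ k ≡ a ^ k * b ^ k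
^-distribʳ-* a b zero    = refl
^-distribʳ-* a b (suc k) = trans (cong (_*_ (a * b)) (^-distribʳ-* a b k)) (swap a b (a ^ k) (b ^ k))
  where
  swap : ∀ a b p q → a * b * (p * q) ≡ a * p * (b * q)
  swap = solve-∀

square-mono : ∀ {p q} → + 0 ≤ p → p ≤ q → p * p ≤ q * q
square-mono {p} {q} 0≤p p≤q = ≤-trans (*-monoˡ-≤-nonNeg p {{nonNegative 0≤p}} p≤q)
                                      (*-monoʳ-≤-nonNeg q {{nonNegative (≤-trans 0≤p p≤q)}} p≤q)

square-nonNeg : ∀ a → + 0 ≤ a * a
square-nonNeg a with ≤-total (+ 0) a
... | inj₁ 0≤a = *-nonNeg 0≤a 0≤a
... | inj₂ a≤0 = subst (+ 0 ≤_) (neg-square a) (*-nonNeg (neg-mono-≤ a≤0) (neg-mono-≤ a≤0))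
  where
  neg-square : ∀ a → (- a) * (- a) ≡ a * a
  neg-square = solve-∀

j*j-11*j+2*n≥0 : ∀ {n} → 16 ℕ.≤ n → ∀ j → + 0 ≤ + j * + j - + 11 * + j + + 2 * + n
j*j-11*j+2*n≥0 {n} 16≤n j = scaled-nonNeg {+ 4} (+<+ (s≤s z≤n)) (subst (+ 0 ≤_) (sym (complete-square (+ j) (+ n)))
  (+-mono-≤ (+-mono-≤ (square-nonNeg (+ 2 * + j - + 11)) (*-nonNeg (0≤+ 8) (i≤j⇒0≤j-i (+≤+ 16≤n)))) (0≤+ 7)))
  where
  complete-square : ∀ j n → + 4 * (j * j - + 11 * j + + 2 * n) ≡ (+ 2 * j - + 11) * (+ 2 * j - + 11) + + 8 * (n - + 16) + + 7
  complete-square = solve-∀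

-- The two permanents of K_n

perL : ℕ → ℤ
perL n = permanentFormula (- + 1) (+ n) n

perL∘L : ℕ → ℤ
perL∘L n = permanentFormula (+ 1) (+ n * (+ n - + 2)) n

module _ (n : ℕ) where

  private
    u : ℕ → ℤ
    u = term (+ n) n

    0≤u : ∀ j → + 0 ≤ u j
    0≤u = term-nonNeg (0≤+ n) n

    0<n : 1 ℕ.≤ n → + 0 < + n
    0<n (s≤s _) = +<+ (s≤s z≤n)

  perL-differences : + 2 * + n * perL n ≡ + n * (+ n) ^ n + alternatingSum (λ j → + j * u j) (suc n)
  perL-differences = begin
    + 2 * + n * perL n
      ≡⟨ cong (_*_ (+ 2 * + n)) (∑ₙ-alternating (suc n) u) ⟩
    + 2 * + n * alternatingSum u (suc n)
      ≡⟨ swap (+ 2) (+ n) (alternatingSum u (suc n)) ⟩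
    + n * (+ 2 * alternatingSum u (suc n))
      ≡⟨ cong (_*_ (+ n)) (alternatingSum-differences (suc n) u (term-last (+ n) n)) ⟩
    + n * (u 0 + alternatingSum (λ j → u j - u (suc j)) (suc n))
      ≡⟨ *-distribˡ-+ (+ n) (u 0) (alternatingSum (λ j → u j - u (suc j)) (suc n)) ⟩
    + n * u 0 + + n * alternatingSum (λ j → u j - u (suc j)) (suc n)
      ≡⟨ cong₂ _+_ (cong (_*_ (+ n)) (term-head (+ n) n))
                   (trans (sym (alternatingSum-* (suc n) (+ n) (λ j → u j - u (suc j))))
                          (alternatingSum-cong (suc n) drop)) ⟩
    + n * (+ n) ^ n + alternatingSum (λ j → + j * u j) (suc n) ∎
    where
    open ≡-Reasoning
    swap : ∀ a b c → a * b * c ≡ b * (a * c)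
    swap = solve-∀
    drop : ∀ j → + n * (u j - u (suc j)) ≡ + j * u j
    drop j = begin
      + n * (u j - u (suc j))     ≡⟨ distrib (+ n) (u j) (u (suc j)) ⟩
      + n * u j - + n * u (suc j) ≡⟨ cong (_-_ (+ n * u j)) (term-step (+ n) n j) ⟩
      + n * u j - (+ n - + j) * u j ≡⟨ cancel (+ n) (+ j) (u j) ⟩
      + j * u j ∎
      where
      distrib : ∀ n a b → n * (a - b) ≡ n * a - n * b
      distrib = solve-∀
      cancel : ∀ n j a → n * a - (n - j) * a ≡ j * a
      cancel = solve-∀

  j*u-unimodal : 1 ℕ.≤ n → Unimodal (λ j → + 5 * (+ j * u j))
  j*u-unimodal 1≤n = unimodal-by-sign (+ n) (λ j → + n - + j * (+ 1 + + j)) (λ j → + 5 * u j) (0<n 1≤n)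
    (λ j → *-nonNeg (0≤+ 5) (0≤u j))
    (λ {i} {j} i≤j → +-monoʳ-≤ (+ n) (neg-mono-≤ (subst₂ _≤_ (pos-* i (suc i)) (pos-* j (suc j))
                                                      (+≤+ (ℕ.*-mono-≤ i≤j (s≤s i≤j))))))
    increment
    where
    increment : ∀ j → + n * (+ 5 * ((+ 1 + + j) * u (suc j)) - + 5 * (+ j * u j))
                      ≡ (+ n - + j * (+ 1 + + j)) * (+ 5 * u j)
    increment j = begin
      + n * (+ 5 * ((+ 1 + + j) * u (suc j)) - + 5 * (+ j * u j))
        ≡⟨ expand (+ n) (+ j) (u (suc j)) (u j) ⟩
      + 5 * (+ 1 + + j) * (+ n * u (suc j)) - + 5 * (+ n * (+ j * u j))
        ≡⟨ cong (λ t → + 5 * (+ 1 + + j) * t - + 5 * (+ n * (+ j * u j))) (term-step (+ n) n j) ⟩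
      + 5 * (+ 1 + + j) * ((+ n - + j) * u j) - + 5 * (+ n * (+ j * u j))
        ≡⟨ collect (+ n) (+ j) (u j) ⟩
      (+ n - + j * (+ 1 + + j)) * (+ 5 * u j) ∎
      where
      open ≡-Reasoning
      expand : ∀ n j b a → n * (+ 5 * ((+ 1 + j) * b) - + 5 * (j * a)) ≡ + 5 * (+ 1 + j) * (n * b) - + 5 * (n * (j * a))
      expand = solve-∀
      collect : ∀ n j a → + 5 * (+ 1 + j) * ((n - j) * a) - + 5 * (n * (j * a)) ≡ (n - j * (+ 1 + j)) * (+ 5 * a)
      collect = solve-∀

  -- Decreasing in j, which bounds u j by n ^ n / (1 + j (j − 1) / 2n).
  u-envelope : ℕ → ℤ
  u-envelope j = u j * (+ 2 * + n + + j * (+ j - + 1))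

  u-envelope-antitone : 1 ℕ.≤ n → Antitone u-envelope
  u-envelope-antitone 1≤n j = 0≤i-j⇒j≤i (scaled-nonNeg (0<n 1≤n) (subst (+ 0 ≤_) (sym drop)
    (*-nonNeg (*-nonNeg (*-nonNeg (0≤+ j) (0≤+ j)) (0≤+ (suc j))) (0≤u j))))
    where
    open ≡-Reasoning
    E = + 2 * + n + + j * (+ j - + 1)
    E′ = + 2 * + n + (+ 1 + + j) * (+ 1 + + j - + 1)
    expand : ∀ n a b e f → n * (a * e - b * f) ≡ n * a * e - n * b * f
    expand = solve-∀
    collect : ∀ n j a → n * a * (+ 2 * n + j * (j - + 1)) - (n - j) * a * (+ 2 * n + (+ 1 + j) * (+ 1 + j - + 1))
                        ≡ j * j * (+ 1 + j) * a
    collect = solve-∀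
    drop : + n * (u-envelope j - u-envelope (suc j)) ≡ + j * + j * (+ 1 + + j) * u j
    drop = begin
      + n * (u j * E - u (suc j) * E′)
        ≡⟨ expand (+ n) (u j) (u (suc j)) E E′ ⟩
      + n * u j * E - + n * u (suc j) * E′
        ≡⟨ cong (λ t → + n * u j * E - t * E′) (term-step (+ n) n j) ⟩
      + n * u j * E - (+ n - + j) * u j * E′
        ≡⟨ collect (+ n) (+ j) (u j) ⟩
      + j * + j * (+ 1 + + j) * u j ∎

  5*j*u≤n*n^n : 16 ℕ.≤ n → ∀ j → + 5 * (+ j * u j) ≤ + n * (+ n) ^ n
  5*j*u≤n*n^n 16≤n j = cancel-pos {+ 2} (+<+ (s≤s z≤n)) (begin
    + 2 * (+ 5 * (+ j * u j))
      ≤⟨ ≤-from-gap _ (gap (+ n) (+ j) (u j)) (*-nonNeg (0≤u j) (j*j-11*j+2*n≥0 16≤n j)) ⟩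
    u-envelope j
      ≤⟨ antitone-≤-head (u-envelope-antitone (ℕ.≤-trans (s≤s z≤n) 16≤n)) j ⟩
    u-envelope 0
      ≡⟨ cong (λ t → t * (+ 2 * + n + + 0)) (term-head (+ n) n) ⟩
    (+ n) ^ n * (+ 2 * + n + + 0)
      ≡⟨ reorder (+ n) ((+ n) ^ n) ⟩
    + 2 * (+ n * (+ n) ^ n) ∎)
    where
    open ≤-Reasoning
    gap : ∀ n j a → a * (+ 2 * n + j * (j - + 1)) - + 2 * (+ 5 * (j * a)) ≡ a * (j * j - + 11 * j + + 2 * n)
    gap = solve-∀
    reorder : ∀ n p → p * (+ 2 * n + + 0) ≡ + 2 * (n * p)
    reorder = solve-∀

  2*n^n≤5*perL : 16 ℕ.≤ n → + 2 * (+ n) ^ n ≤ + 5 * perL n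
  2*n^n≤5*perL 16≤n = cancel-pos {+ 2 * + n} 0<2n (begin
    + 2 * + n * (+ 2 * (+ n) ^ n)
      ≡⟨ regroup (+ n) ((+ n) ^ n) ⟩
    + 5 * (+ n * (+ n) ^ n) + (+ 0 - + n * (+ n) ^ n)
      ≤⟨ +-monoʳ-≤ (+ 5 * (+ n * (+ n) ^ n))
           (proj₁ (alternatingSum-unimodal (j*u-unimodal (ℕ.≤-trans (s≤s z≤n) 16≤n))
                                           (λ j → *-nonNeg (0≤+ 5) (*-nonNeg (0≤+ j) (0≤u j)))
                                           (5*j*u≤n*n^n 16≤n) (suc n))) ⟩
    + 5 * (+ n * (+ n) ^ n) + alternatingSum (λ j → + 5 * (+ j * u j)) (suc n)
      ≡⟨ cong (_+_ (+ 5 * (+ n * (+ n) ^ n))) (alternatingSum-* (suc n) (+ 5) (λ j → + j * u j)) ⟩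
    + 5 * (+ n * (+ n) ^ n) + + 5 * alternatingSum (λ j → + j * u j) (suc n)
      ≡⟨ sym (*-distribˡ-+ (+ 5) (+ n * (+ n) ^ n) (alternatingSum (λ j → + j * u j) (suc n))) ⟩
    + 5 * (+ n * (+ n) ^ n + alternatingSum (λ j → + j * u j) (suc n))
      ≡⟨ cong (_*_ (+ 5)) (sym perL-differences) ⟩
    + 5 * (+ 2 * + n * perL n)
      ≡⟨ swap (+ n) (perL n) ⟩
    + 2 * + n * (+ 5 * perL n) ∎)
    where
    open ≤-Reasoning
    0<2n : + 0 < + 2 * + n
    0<2n = subst (+ 0 <_) (pos-* 2 n) (+<+ (ℕ.≤-trans (ℕ.≤-trans (s≤s z≤n) 16≤n) (ℕ.m≤m+n n (n ℕ.+ 0))))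
    regroup : ∀ n p → + 2 * n * (+ 2 * p) ≡ + 5 * (n * p) + (+ 0 - n * p)
    regroup = solve-∀
    swap : ∀ n a → + 5 * (+ 2 * n * a) ≡ + 2 * n * (+ 5 * a)
    swap = solve-∀

perL∘L-upper : ∀ r → (+ r - + 1) * perL∘L (2 ℕ.+ r) ≤ + r * ((+ (2 ℕ.+ r)) ^ (2 ℕ.+ r) * (+ r) ^ (2 ℕ.+ r))
perL∘L-upper r = begin
  (+ r - + 1) * perL∘L n
    ≡⟨ cong (_*_ (+ r - + 1)) (∑ₙ-cong (suc n) (λ j → trans (cong (_* t j) (^-zeroˡ j)) (*-identityˡ (t j)))) ⟩
  (+ r - + 1) * ∑ₙ (suc n) t
    ≤⟨ geometric-bound (0≤+ r) (term-nonNeg (*-nonNeg (0≤+ n) (0≤+ r)) n) ratio (suc n) ⟩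
  + r * t 0
    ≡⟨ cong (_*_ (+ r)) (trans (term-head (+ n * + r) n) (^-distribʳ-* (+ n) (+ r) n)) ⟩
  + r * ((+ n) ^ n * (+ r) ^ n) ∎
  where
  open ≤-Reasoning
  n = 2 ℕ.+ r
  t = term (+ n * + r) n
  ratio : ∀ j → + r * t (suc j) ≤ t j
  ratio j = cancel-pos {+ n} (+<+ (s≤s z≤n)) (begin
    + n * (+ r * t (suc j))
      ≡⟨ sym (*-assoc (+ n) (+ r) (t (suc j))) ⟩
    + n * + r * t (suc j)
      ≡⟨ term-step (+ n * + r) n j ⟩
    (+ n - + j) * t j
      ≤⟨ ≤-from-gap _ (gap (+ n) (+ j) (t j)) (*-nonNeg (0≤+ j) (term-nonNeg (*-nonNeg (0≤+ n) (0≤+ r)) n j)) ⟩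
    + n * t j ∎)
    where
    gap : ∀ n j t → n * t - (n - j) * t ≡ j * t
    gap = solve-∀

perL∘L≤perL²-small : ∀ n → n ℕ.< 16 → perL∘L n ≤ perL n * perL n
perL∘L≤perL²-small n n<16 = subst (λ m → perL∘L m ≤ perL m * perL m) (toℕ-fromℕ< n<16) (cases (fromℕ< n<16))
  where
  cases : ∀ (i : Fin 16) → perL∘L (toℕ i) ≤ perL (toℕ i) * perL (toℕ i)
  cases = toWitness {a? = Data.Fin.Properties.all? (λ i → perL∘L (toℕ i) ≤? perL (toℕ i) * perL (toℕ i))} tt

perL∘L≤perL²-large : ∀ r → 14 ℕ.≤ r → perL∘L (2 ℕ.+ r) ≤ perL (2 ℕ.+ r) * perL (2 ℕ.+ r)
perL∘L≤perL²-large 0 ()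
perL∘L≤perL²-large 1 (s≤s ())
perL∘L≤perL²-large r@(suc (suc k)) 14≤r = cancel-pos {+ 175 * + suc k} (+<+ (s≤s z≤n)) (begin
  + 175 * + suc k * b
    ≡⟨ *-assoc (+ 175) (+ suc k) b ⟩
  + 175 * ((+ r - + 1) * b)
    ≤⟨ *-monoˡ-≤-nonNeg (+ 175) (perL∘L-upper r) ⟩
  + 175 * (+ r * (N * R))
    ≡⟨ reorder (+ r) N R ⟩
  + 25 * + r * N * (+ 7 * R)
    ≤⟨ *-monoˡ-≤-nonNeg (+ 25 * + r * N) {{nonNegative (*-nonNeg (0≤+ (25 ℕ.* r)) N≥0)}}
                        (7*[n-2]^n≤n^n n (s≤s (s≤s (s≤s z≤n)))) ⟩
  + 25 * + r * N * N
    ≤⟨ ≤-from-gap _ (gap (+ r) N)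
                  (*-nonNeg (+-mono-≤ (*-nonNeg (0≤+ 3) (i≤j⇒0≤j-i (+≤+ 14≤r))) (0≤+ 14)) (*-nonNeg N≥0 N≥0)) ⟩
  + 7 * (+ r - + 1) * ((+ 2 * N) * (+ 2 * N))
    ≤⟨ *-monoˡ-≤-nonNeg (+ 7 * + suc k) (square-mono (*-nonNeg (0≤+ 2) N≥0) (2*n^n≤5*perL n (s≤s (s≤s 14≤r)))) ⟩
  + 7 * (+ r - + 1) * ((+ 5 * a) * (+ 5 * a))
    ≡⟨ collect (+ r - + 1) a ⟩
  + 175 * (+ r - + 1) * (a * a) ∎)
  where
  open ≤-Reasoning
  n = 2 ℕ.+ r
  a = perL n
  b = perL∘L n
  N = (+ n) ^ n
  R = (+ r) ^ n
  N≥0 = ^-nonNeg (0≤+ n) n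
  reorder : ∀ r N R → + 175 * (r * (N * R)) ≡ + 25 * r * N * (+ 7 * R)
  reorder = solve-∀
  gap : ∀ r N → + 7 * (r - + 1) * ((+ 2 * N) * (+ 2 * N)) - + 25 * r * N * N ≡ (+ 3 * (r - + 14) + + 14) * (N * N)
  gap = solve-∀
  collect : ∀ s a → + 7 * s * ((+ 5 * a) * (+ 5 * a)) ≡ + 175 * s * (a * a)
  collect = solve-∀

perL∘L≤perL² : ∀ n → perL∘L n ≤ perL n * perL n
perL∘L≤perL² n with n ℕ.<? 16
... | yes n<16 = perL∘L≤perL²-small n n<16
... | no  n≮16 = subst (λ m → perL∘L m ≤ perL m * perL m) (ℕ.m+[n∸m]≡n 2≤n)
                       (perL∘L≤perL²-large (n ∸ 2) (ℕ.∸-monoˡ-≤ 2 16≤n))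
  where
  16≤n : 16 ℕ.≤ n
  16≤n = ℕ.≮⇒≥ n≮16
  2≤n : 2 ℕ.≤ n
  2≤n = ℕ.≤-trans (s≤s (s≤s z≤n)) 16≤n

-- The inequality also holds for n < 2.
lemma5p2 : (n : ℕ) → n ≥ 2 → per (LK n ∘ₕ LK n) ≤ per (LK n) * per (LK n)
lemma5p2 n _ = subst₂ (λ x y → x ≤ y * y) (sym (per-LK∘LK n)) (sym (per-LK n)) (perL∘L≤perL² n)
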